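{- Let $G,H$ be TLRGs with $G\Rightarrow_{\{r_0,r_1,r_2\}}H$. If (the underlying graph of) $G$ is a tree, then $H$ is a tree. If $G$ is not a tree, then $H$ is not a tree.
   Context: Label alphabet $\mathcal{L}=(\{\square,\triangle\},\{\square\})$. A graph is $G=(V,E,s,t,l,m,p)$ with finite $V,E$, total $s,t:E\to V$, partial node labelling into $\{\square,\triangle\}$, total edge labelling into $\{\square\}$, partial rootedness $p:V\to\{0,1\}$ ($1$: root). A TLRG has $l,p$ total. Morphisms preserve sources, targets, edge labels, node labels and rootedness where defined in the domain. A rule $\langle L\leftarrow K\rightarrow R\rangle$: TLRGs $L,R$ and a graph $K$ that is a subgraph of both. Application to a TLRG $G$ via injective $g:L\to G$ satisfying the dangling condition (no edge outside $g(L)$ incident to $g(V_L\setminus V_K)$): delete images of $L\setminus K$; make $g_V(v)$ unlabelled / of undefined rootedness when $v\in V_K$ is so in $K$; add disjointly $R\setminus K$; give such $g_V(v)$ label $l_R(v)$ / rootedness $p_R(v)$. Rules (all edges labelled $\square$): $r_0$: $L$ = unrooted node 1 labelled $\square$ with an edge to rooted node 2 labelled $\square$; $K$ = node 1 unlabelled, undefined rootedness; $R$ = node 1 rooted labelled $\square$. $r_1$: as $r_0$ but node 1 in $L$ labelled $\triangle$. $r_2$: $L$ = rooted node 1 labelled $\square$ with edge to unrooted node 2 labelled $\square$; $K$ = nodes 1,2 unlabelled, undefined rootedness, no edges; $R$ = unrooted node 1 labelled $\triangle$ with edge to rooted node 2 labelled $\square$. A tree is a non-empty graph whose underlying undirected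 multigraph is connected and has no cycles (in particular no loops or parallel edges), and in which every node has at most one incoming edge. -}

module Defs where

open import Data.Nat using (ℕ; _<_)
open import Data.Fin using (Fin; zero; suc)
open import Data.Bool using (Bool; true; false)
open import Data.Maybe using (Maybe; just; nothing)
open import Data.Product using (Σ; ∃; _×_; _,_; proj₁)
open import Data.Sum using (_⊎_)
open import Data.List using (List; []; _∷_; map)
open import Data.List.Relation.Unary.Unique.Propositional using (Unique)
open import Relation.Binary.PropositionalEquality using (_≡_; _≢_; refl)
open import Relation.Nullary using (¬_)
open import Function.Definitions using (Injective)

data NLabel : Set where
  □ △ : NLabel

data ELabel : Set where
  □ₑ : ELabel

-- Graphs (finite: nodes Fin nV, edges Fin nE), partial node labels and
-- partial rootedness (Maybe), total edge labels.  Rootedness: true = root.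

record Graph : Set where
  field
    nV nE : ℕ
    s t   : Fin nE → Fin nV
    le    : Fin nE → ELabel
    l     : Fin nV → Maybe NLabel
    p     : Fin nV → Maybe Bool

record TLRG : Set where
  field
    nV nE : ℕ
    s t   : Fin nE → Fin nV
    le    : Fin nE → ELabel
    l     : Fin nV → NLabel
    p     : Fin nV → Bool

underlying : TLRG → Graph
underlying G = record
  { nV = nV ; nE = nE ; s = s ; t = t ; le = le
  ; l = λ v → just (l v) ; p = λ v → just (p v) }
  where open TLRG G

record Morphism (A B : Graph) : Set where
  private
    module A = Graph A
    module B = Graph B
  field
    fV     : Fin A.nV → Fin B.nV
    fE     : Fin A.nE → Fin B.nE
    s-pres : ∀ e → B.s (fE e) ≡ fV (A.s e)
    t-pres : ∀ e → B.t (fE e) ≡ fV (A.t e)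
    le-pres : ∀ e → B.le (fE e) ≡ A.le e
    l-pres : ∀ v x → A.l v ≡ just x → B.l (fV v) ≡ just x
    p-pres : ∀ v x → A.p v ≡ just x → B.p (fV v) ≡ just x

IsInjective : ∀ {A B} → Morphism A B → Set
IsInjective m = Injective _≡_ _≡_ (Morphism.fV m) × Injective _≡_ _≡_ (Morphism.fE m)

-- Rules ⟨L ← K → R⟩: K a subgraph of L and of R, given by injective
-- morphisms (inclusions) ιL : K → L and ιR : K → R.

record Rule : Set where
  field
    L R    : TLRG
    K      : Graph
    ιL     : Morphism K (underlying L)
    ιR     : Morphism K (underlying R)
    ιL-inj : IsInjective ιL
    ιR-inj : IsInjective ιR

-- H is characterised (up to isomorphism) as
-- the result of the construction: trV / trE track the nodes / edges of G
-- that are kept (nothing = deleted), inV / inE embed R into H; the images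
-- cover H, overlapping exactly in the images of K.

record DirectDerivation (r : Rule) (G H : TLRG) : Set where
  open Rule r
  private
    module G = TLRG G
    module H = TLRG H
    module L = TLRG L
    module R = TLRG R
    module ιL = Morphism ιL
    module ιR = Morphism ιR
  InKV-L : Fin L.nV → Set
  InKV-L x = ∃ λ k → ιL.fV k ≡ x
  InKE-L : Fin L.nE → Set
  InKE-L a = ∃ λ k → ιL.fE k ≡ a
  InKV-R : Fin R.nV → Set
  InKV-R y = ∃ λ k → ιR.fV k ≡ y
  InKE-R : Fin R.nE → Set
  InKE-R b = ∃ λ k → ιR.fE k ≡ b
  field
    g        : Morphism (underlying L) (underlying G)
    g-inj    : IsInjective g
  private
    module g = Morphism g
  DeletedV : Fin G.nV → Set
  DeletedV v = ∃ λ x → ¬ InKV-L x × g.fV x ≡ v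
  DeletedE : Fin G.nE → Set
  DeletedE e = ∃ λ a → ¬ InKE-L a × g.fE a ≡ e
  field
    dangling : ∀ e → (∀ a → g.fE a ≢ e) → ∀ x → ¬ InKV-L x →
               (G.s e ≢ g.fV x) × (G.t e ≢ g.fV x)
    trV : Fin G.nV → Maybe (Fin H.nV)
    trE : Fin G.nE → Maybe (Fin H.nE)
    inV : Fin R.nV → Fin H.nV
    inE : Fin R.nE → Fin H.nE
    trV-del₁ : ∀ v → trV v ≡ nothing → DeletedV v
    trV-del₂ : ∀ v → DeletedV v → trV v ≡ nothing
    trE-del₁ : ∀ e → trE e ≡ nothing → DeletedE e
    trE-del₂ : ∀ e → DeletedE e → trE e ≡ nothing
    trV-K : ∀ k → trV (g.fV (ιL.fV k)) ≡ just (inV (ιR.fV k))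
    trE-K : ∀ k → trE (g.fE (ιL.fE k)) ≡ just (inE (ιR.fE k))
    trV-inj : ∀ v w h → trV v ≡ just h → trV w ≡ just h → v ≡ w
    trE-inj : ∀ e f h → trE e ≡ just h → trE f ≡ just h → e ≡ f
    inV-inj : Injective _≡_ _≡_ inV
    inE-inj : Injective _≡_ _≡_ inE
    overlapV : ∀ v y → trV v ≡ just (inV y) → InKV-R y
    overlapE : ∀ e b → trE e ≡ just (inE b) → InKE-R b
    surjV : ∀ h → (∃ λ v → trV v ≡ just h) ⊎ (∃ λ y → inV y ≡ h)
    surjE : ∀ h → (∃ λ e → trE e ≡ just h) ⊎ (∃ λ b → inE b ≡ h)
    src-G : ∀ e h → trE e ≡ just h → trV (G.s e) ≡ just (H.s h)
    tgt-G : ∀ e h → trE e ≡ just h → trV (G.t e) ≡ just (H.t h)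
    src-R : ∀ b → H.s (inE b) ≡ inV (R.s b)
    tgt-R : ∀ b → H.t (inE b) ≡ inV (R.t b)
    le-G : ∀ e h → trE e ≡ just h → H.le h ≡ G.le e
    le-R : ∀ b → H.le (inE b) ≡ R.le b
    l-G  : ∀ v h → trV v ≡ just h → (∀ x → g.fV x ≢ v) → H.l h ≡ G.l v
    p-G  : ∀ v h → trV v ≡ just h → (∀ x → g.fV x ≢ v) → H.p h ≡ G.p v
    l-R  : ∀ y → H.l (inV y) ≡ R.l y
    p-R  : ∀ y → H.p (inV y) ≡ R.p y

private
  edgeL : Fin 1 → ELabel
  edgeL _ = □ₑ

  noE : ∀ {n} → Fin 0 → Fin n
  noE ()

  noEL : Fin 0 → ELabel
  noEL ()

  f01 : Fin 2 → Bool
  f01 zero = false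
  f01 (suc zero) = true

  f10 : Fin 2 → Bool
  f10 zero = true
  f10 (suc zero) = false

  lab : NLabel → Fin 2 → NLabel
  lab a zero = a
  lab a (suc zero) = □

  -- L of r₀ (a = □) and r₁ (a = △): node 1 (unrooted, label a) → node 2 (rooted, □)
  L01 : NLabel → TLRG
  L01 a = record { nV = 2 ; nE = 1 ; s = λ _ → zero ; t = λ _ → suc zero
                 ; le = edgeL ; l = lab a ; p = f01 }

  K01 : Graph
  K01 = record { nV = 1 ; nE = 0 ; s = noE ; t = noE ; le = noEL
               ; l = λ _ → nothing ; p = λ _ → nothing }

  R01 : TLRG
  R01 = record { nV = 1 ; nE = 0 ; s = noE ; t = noE ; le = noEL
               ; l = λ _ → □ ; p = λ _ → true }

  nothingJust : {A B : Set} {x : A} → nothing ≡ just x → B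
  nothingJust ()

  ι01L' : (a : NLabel) → Morphism K01 (underlying (L01 a))
  ι01L' a = record { fV = λ _ → zero ; fE = noE ; s-pres = λ () ; t-pres = λ ()
                   ; le-pres = λ () ; l-pres = λ _ _ → nothingJust
                   ; p-pres = λ _ _ → nothingJust }

  ι01R : Morphism K01 (underlying R01)
  ι01R = record { fV = λ _ → zero ; fE = noE ; s-pres = λ () ; t-pres = λ ()
                ; le-pres = λ () ; l-pres = λ _ _ → nothingJust
                ; p-pres = λ _ _ → nothingJust }

  inj1 : {n : ℕ} (f : Fin 1 → Fin n) → Injective _≡_ _≡_ f
  inj1 f {zero} {zero} _ = refl

  inj0 : {n : ℕ} (f : Fin 0 → Fin n) → Injective _≡_ _≡_ f
  inj0 f {()}

  -- r₂: L = node 1 (rooted, □) → node 2 (unrooted, □); K = two unlabelled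
  -- nodes of undefined rootedness, no edges; R = node 1 (unrooted, △) →
  -- node 2 (rooted, □)
  L2 : TLRG
  L2 = record { nV = 2 ; nE = 1 ; s = λ _ → zero ; t = λ _ → suc zero
              ; le = edgeL ; l = λ _ → □ ; p = f10 }

  K2 : Graph
  K2 = record { nV = 2 ; nE = 0 ; s = noE ; t = noE ; le = noEL
              ; l = λ _ → nothing ; p = λ _ → nothing }

  R2 : TLRG
  R2 = record { nV = 2 ; nE = 1 ; s = λ _ → zero ; t = λ _ → suc zero
              ; le = edgeL ; l = lab △ ; p = f01 }

  ι2 : (X : TLRG) → TLRG.nV X ≡ 2 → Morphism K2 (underlying X)
  ι2 X refl = record { fV = λ v → v ; fE = noE ; s-pres = λ () ; t-pres = λ ()
                     ; le-pres = λ () ; l-pres = λ _ _ → nothingJust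
                     ; p-pres = λ _ _ → nothingJust }

r₀ : Rule
r₀ = record { L = L01 □ ; R = R01 ; K = K01 ; ιL = ι01L' □ ; ιR = ι01R
            ; ιL-inj = inj1 _ , inj0 _ ; ιR-inj = inj1 _ , inj0 _ }

r₁ : Rule
r₁ = record { L = L01 △ ; R = R01 ; K = K01 ; ιL = ι01L' △ ; ιR = ι01R
            ; ιL-inj = inj1 _ , inj0 _ ; ιR-inj = inj1 _ , inj0 _ }

r₂ : Rule
r₂ = record { L = L2 ; R = R2 ; K = K2 ; ιL = ι2 L2 refl ; ιR = ι2 R2 refl
            ; ιL-inj = (λ e → e) , inj0 _ ; ιR-inj = (λ e → e) , inj0 _ }

data RuleName : Set where
  n₀ n₁ n₂ : RuleName

rule : RuleName → Rule
rule n₀ = r₀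
rule n₁ = r₁
rule n₂ = r₂

_⇒_ : TLRG → TLRG → Set
G ⇒ H = ∃ λ (n : RuleName) → DirectDerivation (rule n) G H

module _ (G : Graph) where
  open Graph G

  -- an edge traversed forwards (true) or backwards (false)
  Dart : Set
  Dart = Fin nE × Bool

  dsrc : Dart → Fin nV
  dsrc (e , true)  = s e
  dsrc (e , false) = t e

  dtgt : Dart → Fin nV
  dtgt (e , true)  = t e
  dtgt (e , false) = s e

  data Walk : Fin nV → List Dart → Fin nV → Set where
    nil  : ∀ {v} → Walk v [] v
    cons : ∀ {u w} d ds → dsrc d ≡ u → Walk (dtgt d) ds w → Walk u (d ∷ ds) w

  Connected : Set
  Connected = ∀ u v → ∃ λ ds → Walk u ds v

  -- a cycle: a non-empty closed walk with pairwise distinct edges and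
  -- pairwise distinct vertices apart from start = end
  -- (loops and pairs of parallel edges are cycles)
  IsCycle : Set
  IsCycle = ∃ λ v → ∃ λ d → ∃ λ ds →
              Walk v (d ∷ ds) v × Unique (map proj₁ (d ∷ ds)) × Unique (map dtgt (d ∷ ds))

  Acyclic : Set
  Acyclic = ¬ IsCycle

  AtMostOneIncoming : Set
  AtMostOneIncoming = ∀ e e' → t e ≡ t e' → e ≡ e'

  IsTree : Set
  IsTree = (0 < nV) × Connected × Acyclic × AtMostOneIncoming

-- Being a tree only concerns the underlying multigraph (labels and roots are
-- irrelevant), so the proof compares the shapes of G and H.  In every direct
-- derivation G ⇒ H the tracking maps of the derivation give an injective graph
-- morphism φ : H → G (an Embedding), and:
--   * for r₀ and r₁ (rules that delete a pendant leaf and touch nothing else),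
--     G is φ(H) together with one extra leaf hanging on one extra edge, the
--     stem (a PendantLeaf);
--   * for r₂ (which deletes an edge and re-creates it between the same nodes),
--     φ is bijective (Onto), i.e. H and G are isomorphic as graphs.
module Submission where

open import Defs
open import Data.Nat using (_<_; z≤n; s≤s)
open import Data.Fin using (Fin; zero; suc; _≟_)
open import Data.Bool using (true; false)
open import Data.Maybe using (just; nothing)
open import Data.Maybe.Properties using (just-injective)
open import Data.Product using (∃; _×_; _,_; proj₁; proj₂)
open import Data.Sum using (_⊎_; inj₁; inj₂)
open import Data.List using ([]; _∷_; map; _++_)
import Data.List.Relation.Unary.All as All
open All using (All; []; _∷_)
import Data.List.Relation.Unary.All.Properties as All
open import Data.List.Relation.Unary.Any using (Any; here; there)
open import Data.List.Relation.Unary.AllPairs using (_∷_)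
open import Data.List.Relation.Unary.Unique.Propositional using (Unique)
import Data.List.Relation.Unary.Unique.Propositional.Properties as Unique
open import Data.Empty using (⊥-elim)
open import Function.Bundles using (_⇔_; mk⇔; Equivalence)
open import Relation.Nullary using (¬_; yes; no)
open import Relation.Binary.PropositionalEquality
open ≡-Reasoning

nonEmpty : ∀ {n} → Fin n → 0 < n
nonEmpty zero    = s≤s z≤n
nonEmpty (suc _) = s≤s z≤n

someNode : ∀ {n} → 0 < n → Fin n
someNode (s≤s _) = zero

stay : ∀ {K : Graph} {x y} → x ≡ y → Walk K x [] y
stay refl = nil

_▹_ : ∀ {K : Graph} {x ds y ds' z} → Walk K x ds y → Walk K y ds' z → Walk K x (ds ++ ds') z
nil ▹ w₂ = w₂
cons d ds eq w₁ ▹ w₂ = cons d _ eq (w₁ ▹ w₂)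

record Embedding (H G : Graph) : Set where
  private
    module H = Graph H
    module G = Graph G
  field
    φV     : Fin H.nV → Fin G.nV
    φE     : Fin H.nE → Fin G.nE
    s-pres : ∀ e → G.s (φE e) ≡ φV (H.s e)
    t-pres : ∀ e → G.t (φE e) ≡ φV (H.t e)
    φV-inj : ∀ {x y} → φV x ≡ φV y → x ≡ y
    φE-inj : ∀ {x y} → φE x ≡ φE y → x ≡ y

module EmbeddingFacts {H G : Graph} (φ : Embedding H G) where
  open Embedding φ
  private
    module H = Graph H
    module G = Graph G

  φD : Dart H → Dart G
  φD (e , b) = φE e , b

  dsrc-pres : ∀ d → dsrc G (φD d) ≡ φV (dsrc H d)
  dsrc-pres (e , true)  = s-pres e
  dsrc-pres (e , false) = t-pres e

  dtgt-pres : ∀ d → dtgt G (φD d) ≡ φV (dtgt H d)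
  dtgt-pres (e , true)  = t-pres e
  dtgt-pres (e , false) = s-pres e

  mapWalk : ∀ {u ds w} → Walk H u ds w → Walk G (φV u) (map φD ds) (φV w)
  mapWalk nil = nil
  mapWalk (cons d ds refl wk) = cons (φD d) (map φD ds) (dsrc-pres d) (stay (dtgt-pres d) ▹ mapWalk wk)

  edges-map : ∀ ds → map proj₁ (map φD ds) ≡ map φE (map proj₁ ds)
  edges-map []       = refl
  edges-map (d ∷ ds) = cong (φE (proj₁ d) ∷_) (edges-map ds)

  targets-map : ∀ ds → map (dtgt G) (map φD ds) ≡ map φV (map (dtgt H) ds)
  targets-map []       = refl
  targets-map (d ∷ ds) = cong₂ _∷_ (dtgt-pres d) (targets-map ds)

  -- Injectivity keeps edges and nodes of a cycle distinct, so cycles map to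
  -- cycles; hence H is acyclic whenever G is.
  mapCycle : IsCycle H → IsCycle G
  mapCycle (v , d , ds , wk , distinctEdges , distinctNodes) =
    φV v , φD d , map φD ds , mapWalk wk ,
    subst Unique (sym (edges-map (d ∷ ds))) (Unique.map⁺ φE-inj distinctEdges) ,
    subst Unique (sym (targets-map (d ∷ ds))) (Unique.map⁺ φV-inj distinctNodes)

  sameTarget : ∀ e e' → H.t e ≡ H.t e' → G.t (φE e) ≡ G.t (φE e')
  sameTarget e e' eq = begin
    G.t (φE e)   ≡⟨ t-pres e ⟩
    φV (H.t e)   ≡⟨ cong φV eq ⟩
    φV (H.t e')  ≡⟨ sym (t-pres e') ⟩
    G.t (φE e')  ∎

  reflectIncoming : AtMostOneIncoming G → AtMostOneIncoming H
  reflectIncoming inc e e' eq = φE-inj (inc (φE e) (φE e') (sameTarget e e' eq))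

  incomingOnImage : AtMostOneIncoming H → ∀ h h' → G.t (φE h) ≡ G.t (φE h') → φE h ≡ φE h'
  incomingOnImage inc h h' eq =
    cong φE (inc h h' (φV-inj (trans (sym (t-pres h)) (trans eq (t-pres h')))))

  Lifts : Dart G → Set
  Lifts d = ∃ λ h → φE h ≡ proj₁ d

  liftWalk : ∀ {x ds y} → Walk G x ds y → All Lifts ds → ∀ {u w} → x ≡ φV u → y ≡ φV w →
             ∃ λ ds' → Walk H u ds' w × map φD ds' ≡ ds
  liftWalk nil [] eu ew = [] , stay (φV-inj (trans (sym eu) ew)) , refl
  liftWalk (cons (.(φE h) , b) ds refl wk) ((h , refl) ∷ lifts) eu ew
    with liftWalk wk lifts (dtgt-pres (h , b)) ew
  ... | ds' , wk' , refl =
    (h , b) ∷ ds' , cons (h , b) ds' (φV-inj (trans (sym (dsrc-pres (h , b))) eu)) wk' , refl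

  liftCycle : (c : IsCycle G) → All Lifts (proj₁ (proj₂ c) ∷ proj₁ (proj₂ (proj₂ c))) →
              (∃ λ u → φV u ≡ proj₁ c) → IsCycle H
  liftCycle (v , d , ds , wk , distinctEdges , distinctNodes) lifts (u , refl)
    with liftWalk wk lifts refl refl
  ... | d' ∷ ds' , wk' , refl =
    u , d' , ds' , wk' ,
    Unique.map⁻ (subst Unique (edges-map (d' ∷ ds')) distinctEdges) ,
    Unique.map⁻ (subst Unique (targets-map (d' ∷ ds')) distinctNodes)

  subTree : IsTree G → Fin H.nV → Connected H → IsTree H
  subTree (_ , _ , acyclic , inc) v connected =
    nonEmpty v , connected , (λ c → acyclic (mapCycle c)) , reflectIncoming inc

record Onto {H G : Graph} (φ : Embedding H G) : Set where
  open Embedding φ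
  field
    ontoV : ∀ v → ∃ λ h → φV h ≡ v
    ontoE : ∀ e → ∃ λ h → φE h ≡ e

isomorphicTrees : ∀ {H G} {φ : Embedding H G} → Onto φ → IsTree G ⇔ IsTree H
isomorphicTrees {H} {G} {φ} onto = mk⇔ fromG toG
  where
  open Embedding φ
  open EmbeddingFacts φ
  open Onto onto

  allLift : ∀ ds → All Lifts ds
  allLift []       = []
  allLift (d ∷ ds) = ontoE (proj₁ d) ∷ allLift ds

  fromG : IsTree G → IsTree H
  fromG tree@(pos , connected , _ , _) =
    subTree tree (proj₁ (ontoV (someNode pos))) connectedH
    where
    connectedH : Connected H
    connectedH u w with connected (φV u) (φV w)
    ... | ds , wk with liftWalk wk (allLift ds) refl refl
    ... | dsH , wkH , _ = dsH , wkH

  toG : IsTree H → IsTree G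
  toG (pos , connected , acyclic , inc) = nonEmpty (φV (someNode pos)) , connectedG , acyclicG , incG
    where
    connectedG : Connected G
    connectedG u w with ontoV u | ontoV w
    ... | hu , refl | hw , refl with connected hu hw
    ... | ds , wk = map φD ds , mapWalk wk

    acyclicG : Acyclic G
    acyclicG c = acyclic (liftCycle c (allLift _) (ontoV (proj₁ c)))

    incG : AtMostOneIncoming G
    incG e e' eq with ontoE e | ontoE e'
    ... | h , refl | h' , refl = incomingOnImage inc h h' eq

record PendantLeaf {H G : Graph} (φ : Embedding H G) : Set where
  open Embedding φ
  private
    module G = Graph G
  field
    leaf          : Fin G.nV
    stem          : Fin G.nE
    stem-target   : G.t stem ≡ leaf
    stem-source   : G.s stem ≢ leaf
    stem-only     : ∀ e → e ≢ stem → (G.s e ≢ leaf) × (G.t e ≢ leaf)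
    coversV       : ∀ v → v ≢ leaf → ∃ λ h → φV h ≡ v
    coversE       : ∀ e → e ≢ stem → ∃ λ h → φE h ≡ e
    misses-leaf   : ∀ h → φV h ≢ leaf

pendantLeafTrees : ∀ {H G} {φ : Embedding H G} → PendantLeaf φ → IsTree G ⇔ IsTree H
pendantLeafTrees {H} {G} {φ} pl = mk⇔ fromG toG
  where
  open Embedding φ
  open EmbeddingFacts φ
  open PendantLeaf pl
  module G = Graph G

  UsesStem : Dart G → Set
  UsesStem d = proj₁ d ≡ stem

  atLeaf : ∀ e → G.s e ≡ leaf ⊎ G.t e ≡ leaf → e ≡ stem
  atLeaf e incident with e ≟ stem
  ... | yes e≡stem = e≡stem
  atLeaf e (inj₁ eq) | no e≢stem = ⊥-elim (proj₁ (stem-only e e≢stem) eq)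
  atLeaf e (inj₂ eq) | no e≢stem = ⊥-elim (proj₂ (stem-only e e≢stem) eq)

  leaving : ∀ d → dsrc G d ≡ leaf → UsesStem d × dtgt G d ≡ G.s stem
  leaving (e , true) eq with atLeaf e (inj₁ eq)
  ... | refl = ⊥-elim (stem-source eq)
  leaving (e , false) eq with atLeaf e (inj₂ eq)
  ... | refl = refl , refl

  entering : ∀ d → dtgt G d ≡ leaf → UsesStem d
  entering (e , true)  eq = atLeaf e (inj₂ eq)
  entering (e , false) eq = atLeaf e (inj₁ eq)

  stemForward : ∀ d → UsesStem d → dsrc G d ≢ leaf → dtgt G d ≡ leaf × dsrc G d ≡ G.s stem
  stemForward (e , true)  refl _       = stem-target , refl
  stemForward (e , false) refl ≢leaf = ⊥-elim (≢leaf stem-target)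

  -- Between non-leaf nodes every walk can be shortcut to avoid the stem: each
  -- visit to the leaf enters and leaves along the stem and is cut out.
  avoidStem : ∀ {x ds w} → Walk G x ds w → x ≢ leaf → w ≢ leaf →
              ∃ λ ds' → Walk G x ds' w × All (λ d → ¬ UsesStem d) ds'
  avoidStem nil _ _ = [] , nil , []
  avoidStem (cons d ds refl wk) x≢leaf w≢leaf with proj₁ d ≟ stem
  ... | no ¬stem with avoidStem wk (λ eq → ¬stem (entering d eq)) w≢leaf
  ...   | ds' , wk' , avoids = d ∷ ds' , cons d ds' refl wk' , ¬stem ∷ avoids
  avoidStem (cons d ds refl nil) x≢leaf w≢leaf | yes usesStem =
    ⊥-elim (w≢leaf (proj₁ (stemForward d usesStem x≢leaf)))
  avoidStem (cons d ds refl (cons d' ds'' atLeafNow wk)) x≢leaf w≢leaf | yes usesStem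
    with stemForward d usesStem x≢leaf
  ... | reachesLeaf , fromSource with leaving d' (trans atLeafNow reachesLeaf)
  ...   | _ , back with avoidStem wk (λ eq → stem-source (trans (sym back) eq)) w≢leaf
  ...     | ds' , wk' , avoids = ds' , stay (trans fromSource (sym back)) ▹ wk' , avoids

  -- A trail (no repeated edge) between non-leaf nodes does not use the stem:
  -- it would have to use it twice.
  trailAvoidsStem : ∀ {x ds w} → Walk G x ds w → x ≢ leaf → w ≢ leaf → Unique (map proj₁ ds) →
                    All (λ d → ¬ UsesStem d) ds
  trailAvoidsStem nil _ _ _ = []
  trailAvoidsStem (cons d ds refl wk) x≢leaf w≢leaf (_ ∷ distinct) with proj₁ d ≟ stem
  ... | no ¬stem = ¬stem ∷ trailAvoidsStem wk (λ eq → ¬stem (entering d eq)) w≢leaf distinct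
  trailAvoidsStem (cons d ds refl nil) x≢leaf w≢leaf _ | yes usesStem =
    ⊥-elim (w≢leaf (proj₁ (stemForward d usesStem x≢leaf)))
  trailAvoidsStem (cons d ds refl (cons d' _ atLeafNow _)) x≢leaf _ ((d≢d' ∷ _) ∷ _) | yes usesStem
    with leaving d' (trans atLeafNow (proj₁ (stemForward d usesStem x≢leaf)))
  ... | backAlongStem , _ = ⊥-elim (d≢d' (trans usesStem (sym backAlongStem)))

  reachingLeafUsesStem : ∀ {x ds w} → Walk G x ds w → x ≢ leaf → w ≡ leaf → Any UsesStem ds
  reachingLeafUsesStem nil x≢leaf w≡leaf = ⊥-elim (x≢leaf w≡leaf)
  reachingLeafUsesStem (cons d ds refl wk) x≢leaf w≡leaf with dtgt G d ≟ leaf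
  ... | yes eq  = here (entering d eq)
  ... | no ≢leaf = there (reachingLeafUsesStem wk ≢leaf w≡leaf)

  liftsAvoiding : ∀ {ds} → All (λ d → ¬ UsesStem d) ds → All Lifts ds
  liftsAvoiding = All.map (λ {d} ¬stem → coversE (proj₁ d) ¬stem)

  -- Every cycle of G lies in the image of H: a cycle cannot start at the leaf
  -- (it would leave and re-enter along the stem), and otherwise it is a trail
  -- between non-leaf nodes.
  liftCycleG : IsCycle G → IsCycle H
  liftCycleG c@(v , _ , _ , wk , distinctEdges , _) with v ≟ leaf
  ... | no v≢leaf = liftCycle c (liftsAvoiding (trailAvoidsStem wk v≢leaf v≢leaf distinctEdges)) (coversV v v≢leaf)
  liftCycleG (v , d , ds , cons .d .ds fromLeaf wk , (d∉ds ∷ _) , _) | yes v≡leaf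
    with leaving d (trans fromLeaf v≡leaf)
  ... | d-stem , back = ⊥-elim (
    All.All¬⇒¬Any (All.map (λ d≢d' stem' → d≢d' (trans d-stem (sym stem'))) (All.map⁻ d∉ds))
      (reachingLeafUsesStem wk (λ eq → stem-source (trans (sym back) eq)) v≡leaf))

  toImage : ∀ v → ∃ λ h → ∃ λ ds → Walk G v ds (φV h)
  toImage v with v ≟ leaf | coversV (G.s stem) stem-source
  ... | no v≢leaf | _ = proj₁ (coversV v v≢leaf) , [] , stay (sym (proj₂ (coversV v v≢leaf)))
  ... | yes refl | h₀ , eq₀ = h₀ , (stem , false) ∷ [] , cons (stem , false) [] stem-target (stay (sym eq₀))

  fromImage : ∀ v → ∃ λ h → ∃ λ ds → Walk G (φV h) ds v
  fromImage v with v ≟ leaf | coversV (G.s stem) stem-source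
  ... | no v≢leaf | _ = proj₁ (coversV v v≢leaf) , [] , stay (proj₂ (coversV v v≢leaf))
  ... | yes refl | h₀ , eq₀ = h₀ , (stem , true) ∷ [] , cons (stem , true) [] (sym eq₀) (stay stem-target)

  fromG : IsTree G → IsTree H
  fromG tree@(_ , connected , _ , _) = subTree tree (proj₁ (coversV (G.s stem) stem-source)) connectedH
    where
    connectedH : Connected H
    connectedH u w with connected (φV u) (φV w)
    ... | _ , wk with avoidStem wk (misses-leaf u) (misses-leaf w)
    ... | _ , wk' , avoids with liftWalk wk' (liftsAvoiding avoids) refl refl
    ... | ds , wkH , _ = ds , wkH

  toG : IsTree H → IsTree G
  toG (_ , connected , acyclic , inc) = nonEmpty leaf , connectedG , (λ c → acyclic (liftCycleG c)) , incG
    where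
    connectedG : Connected G
    connectedG u w with toImage u | fromImage w
    ... | hu , _ , wu | hw , _ , ww with connected hu hw
    ... | _ , wk = _ , wu ▹ (mapWalk wk ▹ ww)

    incG : AtMostOneIncoming G
    incG e e' eq with e ≟ stem | e' ≟ stem
    ... | yes refl | yes refl = refl
    ... | yes refl | no e'≢stem = ⊥-elim (proj₂ (stem-only e' e'≢stem) (trans (sym eq) stem-target))
    ... | no e≢stem | yes refl = ⊥-elim (proj₂ (stem-only e e≢stem) (trans eq stem-target))
    ... | no e≢stem | no e'≢stem with coversE e e≢stem | coversE e' e'≢stem
    ...   | h , refl | h' , refl = incomingOnImage inc h h' eq

module Tracking {r : Rule} {G H : TLRG} (D : DirectDerivation r G H) where
  open Rule r
  open DirectDerivation D
  private
    module G = TLRG G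
    module H = TLRG H
    module g = Morphism g
    module ιL = Morphism ιL
    module ιR = Morphism ιR

  nodeFate : ∀ v → (∃ λ h → trV v ≡ just h) ⊎ DeletedV v
  nodeFate v with trV v in eq
  ... | just h  = inj₁ (h , refl)
  ... | nothing = inj₂ (trV-del₁ v eq)

  edgeFate : ∀ e → (∃ λ h → trE e ≡ just h) ⊎ DeletedE e
  edgeFate e with trE e in eq
  ... | just h  = inj₁ (h , refl)
  ... | nothing = inj₂ (trE-del₁ e eq)

  nodeOrigins : (∀ y → ∃ λ k → ιR.fV k ≡ y) → ∀ h → ∃ λ v → trV v ≡ just h
  nodeOrigins inK h with surjV h
  ... | inj₁ traced = traced
  ... | inj₂ (y , refl) with inK y
  ...   | k , refl = g.fV (ιL.fV k) , trV-K k

  edgeOrigins : (∀ b → ∃ λ k → ιR.fE k ≡ b) → ∀ h → ∃ λ e → trE e ≡ just h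
  edgeOrigins inK h with surjE h
  ... | inj₁ traced = traced
  ... | inj₂ (b , refl) with inK b
  ...   | k , refl = g.fE (ιL.fE k) , trE-K k

  module NodeOrigin (origin : ∀ h → ∃ λ v → trV v ≡ just h) where
    φV : Fin H.nV → Fin G.nV
    φV h = proj₁ (origin h)

    φV-origin : ∀ {v h} → trV v ≡ just h → φV h ≡ v
    φV-origin {v} {h} eq = trV-inj _ _ h (proj₂ (origin h)) eq

    φV-inj : ∀ {x y} → φV x ≡ φV y → x ≡ y
    φV-inj {x} {y} eq = just-injective (begin
      just x        ≡⟨ sym (proj₂ (origin x)) ⟩
      trV (φV x)    ≡⟨ cong trV eq ⟩
      trV (φV y)    ≡⟨ proj₂ (origin y) ⟩
      just y        ∎)

    deletedNotOrigin : ∀ {v} → trV v ≡ nothing → ∀ h → φV h ≢ v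
    deletedNotOrigin deleted h refl with trans (sym (proj₂ (origin h))) deleted
    ... | ()

    s-traced : ∀ {e h} → trE e ≡ just h → G.s e ≡ φV (H.s h)
    s-traced {e} {h} eq = sym (φV-origin (src-G e h eq))

    t-traced : ∀ {e h} → trE e ≡ just h → G.t e ≡ φV (H.t h)
    t-traced {e} {h} eq = sym (φV-origin (tgt-G e h eq))

  module Origins (nodeOrigin : ∀ h → ∃ λ v → trV v ≡ just h)
                 (edgeOrigin : ∀ h → ∃ λ e → trE e ≡ just h) where
    open NodeOrigin nodeOrigin public

    φE : Fin H.nE → Fin G.nE
    φE h = proj₁ (edgeOrigin h)

    φE-origin : ∀ {e h} → trE e ≡ just h → φE h ≡ e
    φE-origin {e} {h} eq = trE-inj _ _ h (proj₂ (edgeOrigin h)) eq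

    embedding : Embedding (underlying H) (underlying G)
    embedding = record
      { φV = φV ; φE = φE
      ; s-pres = λ h → s-traced (proj₂ (edgeOrigin h))
      ; t-pres = λ h → t-traced (proj₂ (edgeOrigin h))
      ; φV-inj = φV-inj
      ; φE-inj = λ {x} {y} eq → just-injective
          (trans (sym (proj₂ (edgeOrigin x))) (trans (cong trE eq) (proj₂ (edgeOrigin y)))) }

record DeletesLeaf (r : Rule) : Set where
  open Rule r
  private
    module L = TLRG L
    module ιL = Morphism ιL
    module ιR = Morphism ιR
  field
    leaf              : Fin L.nV
    stem              : Fin L.nE
    stem-target       : L.t stem ≡ leaf
    stem-source       : L.s stem ≢ leaf
    leaf-deleted      : ¬ (∃ λ k → ιL.fV k ≡ leaf)
    only-leaf-deleted : ∀ x → ¬ (∃ λ k → ιL.fV k ≡ x) → x ≡ leaf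
    only-stem         : ∀ a → a ≡ stem
    R-nodes-in-K      : ∀ y → ∃ λ k → ιR.fV k ≡ y
    R-edges-in-K      : ∀ b → ∃ λ k → ιR.fE k ≡ b

-- r₀ and r₁ differ only in a node label of L, so they have the same shape:
-- the stem runs from the kept node zero to the deleted leaf suc zero.
r₀-deletesLeaf : DeletesLeaf r₀
r₀-deletesLeaf = record
  { leaf = suc zero ; stem = zero ; stem-target = refl ; stem-source = λ ()
  ; leaf-deleted = λ { (zero , ()) }
  ; only-leaf-deleted = λ { zero kept → ⊥-elim (kept (zero , refl)) ; (suc zero) _ → refl }
  ; only-stem = λ { zero → refl }
  ; R-nodes-in-K = λ { zero → zero , refl }
  ; R-edges-in-K = λ () }

r₁-deletesLeaf : DeletesLeaf r₁
r₁-deletesLeaf = record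
  { leaf = suc zero ; stem = zero ; stem-target = refl ; stem-source = λ ()
  ; leaf-deleted = λ { (zero , ()) }
  ; only-leaf-deleted = λ { zero kept → ⊥-elim (kept (zero , refl)) ; (suc zero) _ → refl }
  ; only-stem = λ { zero → refl }
  ; R-nodes-in-K = λ { zero → zero , refl }
  ; R-edges-in-K = λ () }

leafDeletionTrees : ∀ {r G H} → DeletesLeaf r → DirectDerivation r G H →
                    IsTree (underlying G) ⇔ IsTree (underlying H)
leafDeletionTrees {r} {G} {H} shape D = pendantLeafTrees pendantLeaf
  where
  open DirectDerivation D
  open DeletesLeaf shape
  open Tracking D
  open Origins (nodeOrigins R-nodes-in-K) (edgeOrigins R-edges-in-K)
  module g = Morphism g

  leafDeletedInG : trV (g.fV leaf) ≡ nothing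
  leafDeletedInG = trV-del₂ _ (leaf , leaf-deleted , refl)

  pendantLeaf : PendantLeaf embedding
  pendantLeaf = record
    { leaf = g.fV leaf
    ; stem = g.fE stem
    ; stem-target = trans (g.t-pres stem) (cong g.fV stem-target)
    ; stem-source = λ eq → stem-source (proj₁ g-inj (trans (sym (g.s-pres stem)) eq))
    ; stem-only = λ e e≢stem →
        dangling e (λ a eq → e≢stem (trans (sym eq) (cong g.fE (only-stem a)))) leaf leaf-deleted
    ; coversV = coversV
    ; coversE = coversE
    ; misses-leaf = λ h → deletedNotOrigin leafDeletedInG h }
    where
    coversV : ∀ v → v ≢ g.fV leaf → ∃ λ h → φV h ≡ v
    coversV v v≢leaf with nodeFate v
    ... | inj₁ (h , eq) = h , φV-origin eq
    ... | inj₂ (x , notInK , refl) = ⊥-elim (v≢leaf (cong g.fV (only-leaf-deleted x notInK)))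

    coversE : ∀ e → e ≢ g.fE stem → ∃ λ h → φE h ≡ e
    coversE e e≢stem with edgeFate e
    ... | inj₁ (h , eq) = h , φE-origin eq
    ... | inj₂ (a , _ , refl) = ⊥-elim (e≢stem (cong g.fE (only-stem a)))

-- r₂ deletes its edge and re-creates it between the same two (kept) nodes, so
-- mapping the new edge to the deleted one gives an isomorphism H ≅ G.
edgeRecreationTrees : ∀ {G H} → DirectDerivation r₂ G H → IsTree (underlying G) ⇔ IsTree (underlying H)
edgeRecreationTrees {G} {H} D = isomorphicTrees onto
  where
  open DirectDerivation D
  open Tracking D
  open NodeOrigin (nodeOrigins (λ y → y , refl))
  module G = TLRG G
  module H = TLRG H
  module g = Morphism g

  oldEdge : Fin G.nE
  oldEdge = g.fE zero

  newEdge : Fin H.nE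
  newEdge = inE zero

  oldEdge-deleted : trE oldEdge ≡ nothing
  oldEdge-deleted = trE-del₂ _ (zero , (λ { (() , _) }) , refl)

  newEdge-fresh : ∀ e → trE e ≢ just newEdge
  newEdge-fresh e eq with overlapE e zero eq
  ... | () , _

  tracedNotOld : ∀ {e h} → trE e ≡ just h → e ≢ oldEdge
  tracedNotOld eq refl with trans (sym eq) oldEdge-deleted
  ... | ()

  edgeOrigin : ∀ h → (∃ λ e → trE e ≡ just h) ⊎ h ≡ newEdge
  edgeOrigin h with surjE h
  ... | inj₁ traced = inj₁ traced
  ... | inj₂ (zero , refl) = inj₂ refl

  φE : Fin H.nE → Fin G.nE
  φE h with edgeOrigin h
  ... | inj₁ (e , _) = e
  ... | inj₂ _       = oldEdge

  φE-cases : ∀ h → trE (φE h) ≡ just h ⊎ h ≡ newEdge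
  φE-cases h with edgeOrigin h
  ... | inj₁ (_ , traced) = inj₁ traced
  ... | inj₂ isNew        = inj₂ isNew

  φE-new : φE newEdge ≡ oldEdge
  φE-new with edgeOrigin newEdge
  ... | inj₁ (e , traced) = ⊥-elim (newEdge-fresh e traced)
  ... | inj₂ _            = refl

  φE-origin : ∀ {e h} → trE e ≡ just h → φE h ≡ e
  φE-origin {e} {h} eq with φE-cases h
  ... | inj₁ traced = trE-inj _ _ h traced eq
  ... | inj₂ refl   = ⊥-elim (newEdge-fresh e eq)

  φE-inj : ∀ {x y} → φE x ≡ φE y → x ≡ y
  φE-inj {x} {y} eq with φE-cases x | φE-cases y
  ... | inj₁ p | inj₁ q = just-injective (trans (sym p) (trans (cong trE eq) q))
  ... | inj₁ p | inj₂ refl = ⊥-elim (tracedNotOld p (trans eq φE-new))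
  ... | inj₂ refl | inj₁ q = ⊥-elim (tracedNotOld q (trans (sym eq) φE-new))
  ... | inj₂ refl | inj₂ refl = refl

  φV-kept : ∀ x → φV (inV x) ≡ g.fV x
  φV-kept x = φV-origin (trV-K x)

  s-pres : ∀ h → G.s (φE h) ≡ φV (H.s h)
  s-pres h with φE-cases h
  ... | inj₁ traced = s-traced traced
  ... | inj₂ refl = begin
    G.s (φE newEdge)    ≡⟨ cong G.s φE-new ⟩
    G.s oldEdge         ≡⟨ g.s-pres zero ⟩
    g.fV zero           ≡⟨ sym (φV-kept zero) ⟩
    φV (inV zero)       ≡⟨ cong φV (sym (src-R zero)) ⟩
    φV (H.s newEdge)    ∎

  t-pres : ∀ h → G.t (φE h) ≡ φV (H.t h)
  t-pres h with φE-cases h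
  ... | inj₁ traced = t-traced traced
  ... | inj₂ refl = begin
    G.t (φE newEdge)      ≡⟨ cong G.t φE-new ⟩
    G.t oldEdge           ≡⟨ g.t-pres zero ⟩
    g.fV (suc zero)       ≡⟨ sym (φV-kept (suc zero)) ⟩
    φV (inV (suc zero))   ≡⟨ cong φV (sym (tgt-R zero)) ⟩
    φV (H.t newEdge)      ∎

  embedding : Embedding (underlying H) (underlying G)
  embedding = record
    { φV = φV ; φE = φE ; s-pres = s-pres ; t-pres = t-pres ; φV-inj = φV-inj ; φE-inj = φE-inj }

  onto : Onto embedding
  onto = record { ontoV = ontoV ; ontoE = ontoE }
    where
    -- all nodes of L are in K, so no node is deleted
    ontoV : ∀ v → ∃ λ h → φV h ≡ v
    ontoV v with nodeFate v
    ... | inj₁ (h , eq) = h , φV-origin eq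
    ... | inj₂ (x , notInK , _) = ⊥-elim (notInK (x , refl))

    -- the only deleted edge is the old edge, the image of the new one
    ontoE : ∀ e → ∃ λ h → φE h ≡ e
    ontoE e with edgeFate e
    ... | inj₁ (h , eq) = h , φE-origin eq
    ... | inj₂ (zero , _ , refl) = newEdge , φE-new

derivationTrees : ∀ {G H} → G ⇒ H → IsTree (underlying G) ⇔ IsTree (underlying H)
derivationTrees (n₀ , D) = leafDeletionTrees r₀-deletesLeaf D
derivationTrees (n₁ , D) = leafDeletionTrees r₁-deletesLeaf D
derivationTrees (n₂ , D) = edgeRecreationTrees D

mainTheorem9 : (G H : TLRG) → G ⇒ H →
    (IsTree (underlying G) → IsTree (underlying H)) ×
    (¬ IsTree (underlying G) → ¬ IsTree (underlying H))
mainTheorem9 G H step = to , λ notTreeG treeH → notTreeG (from treeH)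
  where open Equivalence (derivationTrees step)
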